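{- Fix $r$, and for each $n$ let $G_n^r$ be a connected $r$-regular graph on $n$ labeled vertices. Let $P_nG_n^r$ be the graph obtained by identifying the last ($n$-th) vertex of the path $P_n$ on $n$ vertices with vertex $1$ of $G_n^r$. Then \[\lim_{n\to\infty} c_d(P_nG_n^r) = \left(\frac{r-2}{r+2}\right)^2.\]
   Context: For $v\in\mathbb{R}^N_+$ with mean $\mu$ and (population) standard deviation $\sigma$, $\sigma^2=\frac1N\sum_i(v_i-\mu)^2$, set $c_v=(\sigma/\mu)^2$; $c_d(G)=c_d$ where $d$ is the degree vector of $G$. The limit is taken over those $n$ for which $G_n^r$ is given. -}

module Defs where

open import Data.Bool using (Bool; true; false; if_then_else_)
open import Data.Nat as ℕ using (ℕ; zero; suc; _+_; _∸_)
open import Data.Fin using (Fin; toℕ; splitAt)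
open import Data.List using (List; map; foldr; allFin)
open import Data.Sum using (_⊎_; inj₁; inj₂)
open import Data.Integer as ℤ using (ℤ; +_)
open import Data.Rational as ℚ using (ℚ; _/_)
open import Relation.Binary.PropositionalEquality using (_≡_)
open import Relation.Nullary.Decidable using (⌊_⌋)

-- A finite simple graph on vertex set Fin n (labeled vertices 1..n are 0..n-1).
record Graph (n : ℕ) : Set where
  field
    adj    : Fin n → Fin n → Bool
    sym    : ∀ i j → adj i j ≡ adj j i
    irrefl : ∀ i → adj i i ≡ false
open Graph public

sumℕ : List ℕ → ℕ
sumℕ = foldr _+_ 0

degreeA : {m : ℕ} → (Fin m → Fin m → Bool) → Fin m → ℕ
degreeA {m} a i = sumℕ (map (λ j → if a i j then 1 else 0) (allFin m))

degree : {n : ℕ} → Graph n → Fin n → ℕ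
degree G = degreeA (adj G)

Regular : ℕ → {n : ℕ} → Graph n → Set
Regular r G = ∀ i → degree G i ≡ r

data Reach {n : ℕ} (G : Graph n) : Fin n → Fin n → Set where
  here : ∀ {i} → Reach G i i
  step : ∀ {i k j} → adj G i k ≡ true → Reach G k j → Reach G i j

Connected : {n : ℕ} → Graph n → Set
Connected G = ∀ i j → Reach G i j

-- The first (pred n) vertices are the
-- path vertices 1 .. n-1 (index k ↦ path vertex k+1); the last n vertices are
-- the vertices of G (index pred n + v ↦ vertex v+1 of G).  Path vertex n is
-- identified with vertex 1 of G (index pred n + 0).
pathGlueAdj : {n : ℕ} → Graph n → Fin (ℕ.pred n + n) → Fin (ℕ.pred n + n) → Bool
pathGlueAdj {n} G x y with splitAt (ℕ.pred n) x | splitAt (ℕ.pred n) y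
... | inj₁ i | inj₁ j = ⌊ toℕ i ℕ.≟ suc (toℕ j) ⌋ Data.Bool.∨ ⌊ toℕ j ℕ.≟ suc (toℕ i) ⌋
... | inj₁ i | inj₂ v = ⌊ suc (toℕ i) ℕ.≟ ℕ.pred n ⌋ Data.Bool.∧ ⌊ toℕ v ℕ.≟ 0 ⌋
... | inj₂ v | inj₁ j = ⌊ suc (toℕ j) ℕ.≟ ℕ.pred n ⌋ Data.Bool.∧ ⌊ toℕ v ℕ.≟ 0 ⌋
... | inj₂ u | inj₂ v = adj G u v

degVecPathGlue : {n : ℕ} → Graph n → Fin (ℕ.pred n + n) → ℕ
degVecPathGlue G = degreeA (pathGlueAdj G)

-- c_v = (σ/μ)^2 for v ∈ ℕ^N, σ the population standard deviation.
-- μ = S/N with S = Σ v_i;  σ² = (1/N) Σ (v_i - μ)²;  1/μ² = N²/S².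
-- Convention: value 0 when N = 0 or μ = 0 (c_v undefined there).
cv : (N : ℕ) → (Fin N → ℕ) → ℚ
cv zero v = ℚ.0ℚ
cv (suc N) v with sumℕ (map v (allFin (suc N)))
... | zero = ℚ.0ℚ
... | suc s =
  let μ  = (+ suc s) / suc N
      sq = λ (q : ℚ) → q ℚ.* q
      σ² = ((+ 1) / suc N) ℚ.* foldr ℚ._+_ ℚ.0ℚ
             (map (λ i → sq ((+ v i) / 1 ℚ.- μ)) (allFin (suc N)))
  in σ² ℚ.* ((+ (suc N ℕ.* suc N)) / (suc s ℕ.* suc s))

cdPathGlue : {n : ℕ} → Graph n → ℚ
cdPathGlue {n} G = cv (ℕ.pred n + n) (degVecPathGlue G)

target : ℕ → ℚ
target r = let q = (+ r ℤ.- + 2) / (2 + r) in q ℚ.* q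

{-# OPTIONS --safe #-}
module Submission where

-- In P_nG the path contributes one vertex of degree 1 and n − 2 of degree 2, and G contributes
-- the glued vertex of degree r + 1 and n − 1 vertices of degree r.  So there are N = 2n − 1 vertices, with degree sum S = (r + 2)n − 2 and square sum
-- Q = (r² + 4)n + 2r − 6, and the definition of c_v gives c_d = NQ/S² − 1.  Over the common
-- denominator S²(r + 2)², the difference to ((r − 2)/(r + 2))² has numerator
-- (r + 2)²NQ − 2(r² + 4)S², in which the n² terms cancel: the difference is O(n)/Θ(n²).

open import Defs hiding (sym)

open import Algebra.Bundles using (CommutativeMonoid)
import Algebra.Properties.CommutativeSemigroup as CommutativeSemigroupProperties
open import Data.Bool using (Bool; true; false; _∧_; _∨_; if_then_else_)
open import Data.Bool.Properties using (∧-identityʳ; ∧-zeroʳ)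
open import Data.Fin using (Fin; zero; suc; toℕ; _↑ˡ_; _↑ʳ_)
open import Data.Fin.Properties using (splitAt-↑ˡ; splitAt-↑ʳ; toℕ<n)
open import Data.Integer as ℤ using (ℤ; _⊖_)
import Data.Integer.Properties as ℤ
import Data.Integer.Tactic.RingSolver as ℤ
open import Data.List using (List; []; _∷_; map; foldr; length; allFin; tabulate)
open import Data.List.Properties using (map-tabulate; length-tabulate)
open import Data.Maybe using (Maybe; just)
open import Data.Nat as ℕ using (ℕ; zero; suc; _+_; _*_; _⊔_; _≤_; _≡ᵇ_; _<ᵇ_; z≤n; s≤s; s≤s⁻¹; >-nonZero)
open import Data.Nat.Coprimality using (Coprime)
open import Data.Nat.Properties
  using ( +-assoc; +-identityʳ; *-identityʳ; *-zeroʳ; *-distribʳ-+; +-commutativeSemigroup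
        ; ≤-refl; ≤-trans; ≤-<-trans; <⇒≤; n≤1+n; m≤m+n; m≤m*n; m≤n*m; m⊔n≤m+n
        ; +-mono-≤; *-monoʳ-≤; *-monoˡ-≤; *-monoʳ-<; module ≤-Reasoning )
open import Data.Nat.Tactic.RingSolver using () renaming (ring to ℕ-ring)
open import Data.Product using (_×_; ∃-syntax; _,_; proj₁)
open import Data.Rational as ℚ using (ℚ; mkℚ; _/_; _-_; -_; _<_; 0ℚ; 1ℚ; ∣_∣; toℚᵘ)
import Data.Rational.Properties as ℚ
open import Data.Rational.Unnormalised as ℚᵘ using (mkℚᵘ; *≡*; *<*)
import Data.Rational.Unnormalised.Properties as ℚᵘ
open import Function using (_∘_)
open import Level using (0ℓ)
open import Relation.Binary.PropositionalEquality
  using (_≡_; refl; sym; trans; cong; cong₂; subst; subst₂; module ≡-Reasoning)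
open import Relation.Nullary.Decidable using (isYes≗does; dec⇒maybe)
open import Tactic.RingSolver using (solve-∀; solve)
open import Tactic.RingSolver.Core.AlmostCommutativeRing using (AlmostCommutativeRing; fromCommutativeRing)

open CommutativeSemigroupProperties +-commutativeSemigroup using () renaming (interchange to +-interchange)
open CommutativeSemigroupProperties (CommutativeMonoid.commutativeSemigroup ℚ.*-1-commutativeMonoid)
  using () renaming (interchange to *-interchange)

ind : Bool → ℕ
ind b = if b then 1 else 0

sumFin : ∀ {k} → (Fin k → ℕ) → ℕ
sumFin f = sumℕ (tabulate f)

sumℕ-map-allFin : ∀ {k} (f : Fin k → ℕ) → sumℕ (map f (allFin k)) ≡ sumFin f
sumℕ-map-allFin f = cong sumℕ (map-tabulate (λ i → i) f)

sumFin-cong : ∀ k {f g : Fin k → ℕ} → (∀ i → f i ≡ g i) → sumFin f ≡ sumFin g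
sumFin-cong zero    f≗g = refl
sumFin-cong (suc k) f≗g = cong₂ _+_ (f≗g zero) (sumFin-cong k (f≗g ∘ suc))

sumFin-const : ∀ k c → sumFin {k} (λ _ → c) ≡ k * c
sumFin-const zero    c = refl
sumFin-const (suc k) c = cong (c +_) (sumFin-const k c)

sumFin-zero : ∀ k → sumFin {k} (λ _ → 0) ≡ 0
sumFin-zero k = trans (sumFin-const k 0) (*-zeroʳ k)

sumFin-↑ : ∀ a b (f : Fin (a + b) → ℕ) →
           sumFin f ≡ sumFin (f ∘ (_↑ˡ b)) + sumFin (f ∘ (a ↑ʳ_))
sumFin-↑ zero    b f = refl
sumFin-↑ (suc a) b f =
  trans (cong (f zero +_) (sumFin-↑ a b (f ∘ suc))) (sym (+-assoc (f zero) _ _))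

count-≡ᵇ : ∀ k c → sumFin {k} (λ j → ind (toℕ j ≡ᵇ c)) ≡ ind (c <ᵇ k)
count-≡ᵇ zero    c       = refl
count-≡ᵇ (suc k) zero    = cong suc (sumFin-zero k)
count-≡ᵇ (suc k) (suc c) = count-≡ᵇ k c

sumFin-+ : ∀ k (f g : Fin k → ℕ) → sumFin (λ j → f j + g j) ≡ sumFin f + sumFin g
sumFin-+ zero    f g = refl
sumFin-+ (suc k) f g =
  trans (cong (f zero + g zero +_) (sumFin-+ k (f ∘ suc) (g ∘ suc)))
        (+-interchange (f zero) (g zero) (sumFin (f ∘ suc)) (sumFin (g ∘ suc)))

≡ᵇ-comm : ∀ a b → (a ≡ᵇ b) ≡ (b ≡ᵇ a)
≡ᵇ-comm zero    zero    = refl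
≡ᵇ-comm zero    (suc b) = refl
≡ᵇ-comm (suc a) zero    = refl
≡ᵇ-comm (suc a) (suc b) = ≡ᵇ-comm a b

ind-<ᵇ+ind-≡ᵇ : ∀ {k m} → k ≤ m → ind (k <ᵇ m) + ind (k ≡ᵇ m) ≡ 1
ind-<ᵇ+ind-≡ᵇ {m = zero}  z≤n     = refl
ind-<ᵇ+ind-≡ᵇ {m = suc m} z≤n     = refl
ind-<ᵇ+ind-≡ᵇ             (s≤s p) = ind-<ᵇ+ind-≡ᵇ p

<ᵇ-suc : ∀ {k m} → k ≤ m → (k <ᵇ suc m) ≡ true
<ᵇ-suc z≤n     = refl
<ᵇ-suc (s≤s p) = <ᵇ-suc p

-- Both disjuncts would force k ≡ j + 1 and j ≡ k + 1 at once.
ind-∨-neighbour : ∀ k j → ind ((k ≡ᵇ suc j) ∨ (j ≡ᵇ suc k)) ≡ ind (k ≡ᵇ suc j) + ind (j ≡ᵇ suc k)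
ind-∨-neighbour zero          j       = refl
ind-∨-neighbour (suc zero)    zero    = refl
ind-∨-neighbour (suc (suc k)) zero    = refl
ind-∨-neighbour (suc k)       (suc j) = ind-∨-neighbour k j

pathDegree : ℕ → ℕ
pathDegree zero    = 1
pathDegree (suc _) = 2

predecessorCount : ∀ {k m} → k ≤ m → sumFin {suc m} (λ j → ind (k ≡ᵇ suc (toℕ j))) + 1 ≡ pathDegree k
predecessorCount {zero}  {m} _   = cong (_+ 1) (sumFin-zero (suc m))
predecessorCount {suc k} {m} k<m = cong (_+ 1) (begin
  sumFin {suc m} (λ j → ind (k ≡ᵇ toℕ j)) ≡⟨ sumFin-cong (suc m) (λ j → cong ind (≡ᵇ-comm k (toℕ j))) ⟩
  sumFin {suc m} (λ j → ind (toℕ j ≡ᵇ k)) ≡⟨ count-≡ᵇ (suc m) k ⟩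
  ind (k <ᵇ suc m)                        ≡⟨ cong ind (<ᵇ-suc (≤-trans (n≤1+n k) k<m)) ⟩
  1                                       ∎)
  where open ≡-Reasoning

pathNeighbours : ∀ {k m} → k ≤ m →
  sumFin {suc m} (λ j → ind ((k ≡ᵇ suc (toℕ j)) ∨ (toℕ j ≡ᵇ suc k))) + ind (k ≡ᵇ m) ≡ pathDegree k
pathNeighbours {k} {m} k≤m = begin
  sumFin {suc m} (λ j → ind ((k ≡ᵇ suc (toℕ j)) ∨ (toℕ j ≡ᵇ suc k))) + ind (k ≡ᵇ m)
    ≡⟨ cong (_+ ind (k ≡ᵇ m)) (trans (sumFin-cong (suc m) (λ j → ind-∨-neighbour k (toℕ j)))
                                      (sumFin-+ (suc m) predecessor successor)) ⟩
  sumFin predecessor + sumFin successor + ind (k ≡ᵇ m)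
    ≡⟨ +-assoc (sumFin predecessor) _ _ ⟩
  sumFin predecessor + (sumFin successor + ind (k ≡ᵇ m))
    ≡⟨ cong (λ c → sumFin predecessor + (c + ind (k ≡ᵇ m))) (count-≡ᵇ (suc m) (suc k)) ⟩
  sumFin predecessor + (ind (k <ᵇ m) + ind (k ≡ᵇ m))
    ≡⟨ cong (sumFin predecessor +_) (ind-<ᵇ+ind-≡ᵇ k≤m) ⟩
  sumFin predecessor + 1
    ≡⟨ predecessorCount k≤m ⟩
  pathDegree k ∎
  where
  open ≡-Reasoning
  predecessor successor : Fin (suc m) → ℕ
  predecessor j = ind (k ≡ᵇ suc (toℕ j))
  successor   j = ind (toℕ j ≡ᵇ suc k)

sumFin-ind-∧-atZero : ∀ k b → sumFin {suc k} (λ v → ind (b ∧ (toℕ v ≡ᵇ 0))) ≡ ind b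
sumFin-ind-∧-atZero k b = begin
  ind (b ∧ true) + sumFin {k} (λ _ → ind (b ∧ false))
    ≡⟨ cong₂ _+_ (cong ind (∧-identityʳ b)) (sumFin-cong k (λ _ → cong ind (∧-zeroʳ b))) ⟩
  ind b + sumFin {k} (λ _ → 0)
    ≡⟨ cong (ind b +_) (sumFin-zero k) ⟩
  ind b + 0
    ≡⟨ +-identityʳ (ind b) ⟩
  ind b ∎
  where open ≡-Reasoning

module _ {m : ℕ} (G : Graph (suc (suc m))) where

  pathGlueAdj-path-path : ∀ (i j : Fin (suc m)) →
    pathGlueAdj G (i ↑ˡ suc (suc m)) (j ↑ˡ suc (suc m)) ≡ (toℕ i ≡ᵇ suc (toℕ j)) ∨ (toℕ j ≡ᵇ suc (toℕ i))
  pathGlueAdj-path-path i j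
    rewrite splitAt-↑ˡ (suc m) i (suc (suc m)) | splitAt-↑ˡ (suc m) j (suc (suc m))
    = cong₂ _∨_ (isYes≗does (toℕ i ℕ.≟ suc (toℕ j))) (isYes≗does (toℕ j ℕ.≟ suc (toℕ i)))

  pathGlueAdj-path-graph : ∀ (i : Fin (suc m)) (v : Fin (suc (suc m))) →
    pathGlueAdj G (i ↑ˡ suc (suc m)) (suc m ↑ʳ v) ≡ (toℕ i ≡ᵇ m) ∧ (toℕ v ≡ᵇ 0)
  pathGlueAdj-path-graph i v
    rewrite splitAt-↑ˡ (suc m) i (suc (suc m)) | splitAt-↑ʳ (suc m) (suc (suc m)) v
    = cong₂ _∧_ (isYes≗does (suc (toℕ i) ℕ.≟ suc m)) (isYes≗does (toℕ v ℕ.≟ 0))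

  pathGlueAdj-graph-path : ∀ (u : Fin (suc (suc m))) (j : Fin (suc m)) →
    pathGlueAdj G (suc m ↑ʳ u) (j ↑ˡ suc (suc m)) ≡ (toℕ j ≡ᵇ m) ∧ (toℕ u ≡ᵇ 0)
  pathGlueAdj-graph-path u j
    rewrite splitAt-↑ʳ (suc m) (suc (suc m)) u | splitAt-↑ˡ (suc m) j (suc (suc m))
    = cong₂ _∧_ (isYes≗does (suc (toℕ j) ℕ.≟ suc m)) (isYes≗does (toℕ u ℕ.≟ 0))

  pathGlueAdj-graph-graph : ∀ (u v : Fin (suc (suc m))) →
    pathGlueAdj G (suc m ↑ʳ u) (suc m ↑ʳ v) ≡ adj G u v
  pathGlueAdj-graph-graph u v
    rewrite splitAt-↑ʳ (suc m) (suc (suc m)) u | splitAt-↑ʳ (suc m) (suc (suc m)) v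
    = refl

  degVecPathGlue-split : ∀ x → degVecPathGlue G x ≡
    sumFin {suc m} (λ j → ind (pathGlueAdj G x (j ↑ˡ suc (suc m))))
    + sumFin {suc (suc m)} (λ v → ind (pathGlueAdj G x (suc m ↑ʳ v)))
  degVecPathGlue-split x =
    trans (sumℕ-map-allFin (ind ∘ pathGlueAdj G x)) (sumFin-↑ (suc m) (suc (suc m)) (ind ∘ pathGlueAdj G x))

  degVecPathGlue-path : ∀ i → degVecPathGlue G (i ↑ˡ suc (suc m)) ≡ pathDegree (toℕ i)
  degVecPathGlue-path i = begin
    degVecPathGlue G (i ↑ˡ suc (suc m))
      ≡⟨ degVecPathGlue-split (i ↑ˡ suc (suc m)) ⟩
    sumFin {suc m} (λ j → ind (pathGlueAdj G (i ↑ˡ suc (suc m)) (j ↑ˡ suc (suc m))))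
      + sumFin {suc (suc m)} (λ v → ind (pathGlueAdj G (i ↑ˡ suc (suc m)) (suc m ↑ʳ v)))
      ≡⟨ cong₂ _+_ (sumFin-cong (suc m) (cong ind ∘ pathGlueAdj-path-path i))
                   (sumFin-cong (suc (suc m)) (cong ind ∘ pathGlueAdj-path-graph i)) ⟩
    sumFin neighbours + sumFin {suc (suc m)} (λ v → ind ((toℕ i ≡ᵇ m) ∧ (toℕ v ≡ᵇ 0)))
      ≡⟨ cong (sumFin neighbours +_) (sumFin-ind-∧-atZero (suc m) (toℕ i ≡ᵇ m)) ⟩
    sumFin neighbours + ind (toℕ i ≡ᵇ m)
      ≡⟨ pathNeighbours (s≤s⁻¹ (toℕ<n i)) ⟩
    pathDegree (toℕ i) ∎
    where
    open ≡-Reasoning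
    neighbours : Fin (suc m) → ℕ
    neighbours j = ind ((toℕ i ≡ᵇ suc (toℕ j)) ∨ (toℕ j ≡ᵇ suc (toℕ i)))

  attachmentDegree : ∀ u →
    sumFin {suc m} (λ j → ind (pathGlueAdj G (suc m ↑ʳ u) (j ↑ˡ suc (suc m)))) ≡ ind (toℕ u ≡ᵇ 0)
  attachmentDegree zero = begin
    sumFin {suc m} (λ j → ind (pathGlueAdj G (suc m ↑ʳ zero) (j ↑ˡ suc (suc m))))
      ≡⟨ sumFin-cong (suc m) (λ j → cong ind (trans (pathGlueAdj-graph-path zero j) (∧-identityʳ _))) ⟩
    sumFin {suc m} (λ j → ind (toℕ j ≡ᵇ m))
      ≡⟨ count-≡ᵇ (suc m) m ⟩
    ind (m <ᵇ suc m)
      ≡⟨ cong ind (<ᵇ-suc (≤-refl {m})) ⟩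
    1 ∎
    where open ≡-Reasoning
  attachmentDegree (suc u) =
    trans (sumFin-cong (suc m) (λ j → cong ind (trans (pathGlueAdj-graph-path (suc u) j) (∧-zeroʳ _))))
          (sumFin-zero (suc m))

  degVecPathGlue-graph : ∀ {r} → Regular r G → ∀ u → degVecPathGlue G (suc m ↑ʳ u) ≡ ind (toℕ u ≡ᵇ 0) + r
  degVecPathGlue-graph {r} reg u =
    trans (degVecPathGlue-split (suc m ↑ʳ u)) (cong₂ _+_ (attachmentDegree u) neighboursInG)
    where
    neighboursInG : sumFin {suc (suc m)} (λ v → ind (pathGlueAdj G (suc m ↑ʳ u) (suc m ↑ʳ v))) ≡ r
    neighboursInG = trans (sumFin-cong (suc (suc m)) (cong ind ∘ pathGlueAdj-graph-graph u))
                          (trans (sym (sumℕ-map-allFin (ind ∘ adj G u))) (reg u))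

  sum-degVecPathGlue : ∀ {r} → Regular r G → ∀ (f : ℕ → ℕ) →
    sumFin (f ∘ degVecPathGlue G) ≡ f 1 + m * f 2 + (f (suc r) + suc m * f r)
  sum-degVecPathGlue {r} reg f =
    trans (sumFin-↑ (suc m) (suc (suc m)) (f ∘ degVecPathGlue G)) (cong₂ _+_ pathPart graphPart)
    where
    pathPart : sumFin {suc m} (λ i → f (degVecPathGlue G (i ↑ˡ suc (suc m)))) ≡ f 1 + m * f 2
    pathPart = trans (sumFin-cong (suc m) (cong f ∘ degVecPathGlue-path)) (cong (f 1 +_) (sumFin-const m (f 2)))
    graphPart : sumFin {suc (suc m)} (λ u → f (degVecPathGlue G (suc m ↑ʳ u))) ≡ f (suc r) + suc m * f r
    graphPart = trans (sumFin-cong (suc (suc m)) (cong f ∘ degVecPathGlue-graph reg))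
                      (cong (f (suc r) +_) (sumFin-const (suc m) (f r)))

ℚ-ring : AlmostCommutativeRing 0ℓ 0ℓ
ℚ-ring = fromCommutativeRing ℚ.+-*-commutativeRing (λ x → dec⇒maybe (0ℚ ℚ.≟ x))

fromℤ : ℤ → ℚ
fromℤ i = i / 1

fromℕ : ℕ → ℚ
fromℕ k = fromℤ (ℤ.+ k)

toℚᵘ-/ : ∀ i d → toℚᵘ (i / suc d) ℚᵘ.≃ mkℚᵘ i d
toℚᵘ-/ i d = ℚ.toℚᵘ-fromℚᵘ (mkℚᵘ i d)

fromℤ-+ : ∀ i j → fromℤ (i ℤ.+ j) ≡ fromℤ i ℚ.+ fromℤ j
fromℤ-+ i j = ℚ.toℚᵘ-injective (begin
  toℚᵘ (fromℤ (i ℤ.+ j))            ≈⟨ toℚᵘ-/ (i ℤ.+ j) 0 ⟩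
  mkℚᵘ (i ℤ.+ j) 0                  ≈⟨ *≡* cross ⟩
  mkℚᵘ i 0 ℚᵘ.+ mkℚᵘ j 0            ≈⟨ ℚᵘ.+-cong (toℚᵘ-/ i 0) (toℚᵘ-/ j 0) ⟨
  toℚᵘ (fromℤ i) ℚᵘ.+ toℚᵘ (fromℤ j) ≈⟨ ℚ.toℚᵘ-homo-+ (fromℤ i) (fromℤ j) ⟨
  toℚᵘ (fromℤ i ℚ.+ fromℤ j)        ∎)
  where
  open ℚᵘ.≃-Reasoning
  cross : (i ℤ.+ j) ℤ.* ℤ.+ 1 ≡ (i ℤ.* ℤ.+ 1 ℤ.+ j ℤ.* ℤ.+ 1) ℤ.* ℤ.+ 1
  cross = solve (i ∷ j ∷ []) ℤ.ring

fromℤ-* : ∀ i j → fromℤ (i ℤ.* j) ≡ fromℤ i ℚ.* fromℤ j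
fromℤ-* i j = ℚ.toℚᵘ-injective (begin
  toℚᵘ (fromℤ (i ℤ.* j))            ≈⟨ toℚᵘ-/ (i ℤ.* j) 0 ⟩
  mkℚᵘ i 0 ℚᵘ.* mkℚᵘ j 0            ≈⟨ ℚᵘ.*-cong (toℚᵘ-/ i 0) (toℚᵘ-/ j 0) ⟨
  toℚᵘ (fromℤ i) ℚᵘ.* toℚᵘ (fromℤ j) ≈⟨ ℚ.toℚᵘ-homo-* (fromℤ i) (fromℤ j) ⟨
  toℚᵘ (fromℤ i ℚ.* fromℤ j)        ∎)
  where open ℚᵘ.≃-Reasoning

fromℤ-neg : ∀ i → fromℤ (ℤ.- i) ≡ - fromℤ i
fromℤ-neg i = ℚ.toℚᵘ-injective (begin
  toℚᵘ (fromℤ (ℤ.- i)) ≈⟨ toℚᵘ-/ (ℤ.- i) 0 ⟩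
  ℚᵘ.- mkℚᵘ i 0        ≈⟨ ℚᵘ.-‿cong (toℚᵘ-/ i 0) ⟨
  ℚᵘ.- toℚᵘ (fromℤ i)  ≈⟨ ℚ.toℚᵘ-homo‿- (fromℤ i) ⟨
  toℚᵘ (- fromℤ i)     ∎)
  where open ℚᵘ.≃-Reasoning

fromℕ-+ : ∀ a b → fromℕ (a + b) ≡ fromℕ a ℚ.+ fromℕ b
fromℕ-+ a b = trans (cong fromℤ (ℤ.pos-+ a b)) (fromℤ-+ (ℤ.+ a) (ℤ.+ b))

fromℕ-* : ∀ a b → fromℕ (a * b) ≡ fromℕ a ℚ.* fromℕ b
fromℕ-* a b = trans (cong fromℤ (ℤ.pos-* a b)) (fromℤ-* (ℤ.+ a) (ℤ.+ b))

fromℤ-⊖ : ∀ a b → fromℤ (a ⊖ b) ≡ fromℕ a - fromℕ b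
fromℤ-⊖ a b = begin
  fromℤ (a ⊖ b)                        ≡⟨ cong fromℤ (ℤ.m-n≡m⊖n a b) ⟨
  fromℤ (ℤ.+ a ℤ.+ ℤ.- ℤ.+ b)          ≡⟨ fromℤ-+ (ℤ.+ a) (ℤ.- ℤ.+ b) ⟩
  fromℕ a ℚ.+ fromℤ (ℤ.- ℤ.+ b)        ≡⟨ cong (fromℕ a ℚ.+_) (fromℤ-neg (ℤ.+ b)) ⟩
  fromℕ a - fromℕ b                    ∎
  where open ≡-Reasoning

/-*-fromℕ : ∀ i D .{{_ : ℕ.NonZero D}} → (i / D) ℚ.* fromℕ D ≡ fromℤ i
/-*-fromℕ i (suc d) = ℚ.toℚᵘ-injective (begin
  toℚᵘ ((i / suc d) ℚ.* fromℕ (suc d))            ≈⟨ ℚ.toℚᵘ-homo-* (i / suc d) (fromℕ (suc d)) ⟩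
  toℚᵘ (i / suc d) ℚᵘ.* toℚᵘ (fromℕ (suc d))     ≈⟨ ℚᵘ.*-cong (toℚᵘ-/ i d) (toℚᵘ-/ (ℤ.+ suc d) 0) ⟩
  mkℚᵘ i d ℚᵘ.* mkℚᵘ (ℤ.+ suc d) 0               ≈⟨ *≡* cross ⟩
  mkℚᵘ i 0                                       ≈⟨ toℚᵘ-/ i 0 ⟨
  toℚᵘ (fromℤ i)                                 ∎)
  where
  open ℚᵘ.≃-Reasoning
  cross : (i ℤ.* ℤ.+ suc d) ℤ.* ℤ.+ 1 ≡ i ℤ.* ℤ.+ (suc d ℕ.* 1)
  cross = trans (ℤ.*-identityʳ _) (cong (λ e → i ℤ.* ℤ.+ e) (sym (*-identityʳ (suc d))))

*-cancelʳ-invertible : ∀ {x y z} e → e ℚ.* z ≡ 1ℚ → x ℚ.* z ≡ y ℚ.* z → x ≡ y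
*-cancelʳ-invertible {x} {y} {z} e ez≡1 xz≡yz = begin
  x                   ≡⟨ ℚ.*-identityʳ x ⟨
  x ℚ.* 1ℚ            ≡⟨ cong (x ℚ.*_) ez≡1 ⟨
  x ℚ.* (e ℚ.* z)     ≡⟨ solve (x ∷ e ∷ z ∷ []) ℚ-ring ⟩
  x ℚ.* z ℚ.* e       ≡⟨ cong (ℚ._* e) xz≡yz ⟩
  y ℚ.* z ℚ.* e       ≡⟨ solve (y ∷ e ∷ z ∷ []) ℚ-ring ⟩
  y ℚ.* (e ℚ.* z)     ≡⟨ cong (y ℚ.*_) ez≡1 ⟩
  y ℚ.* 1ℚ            ≡⟨ ℚ.*-identityʳ y ⟩
  y                   ∎
  where open ≡-Reasoning

*-fromℕ⇒≡/ : ∀ {x} i D .{{_ : ℕ.NonZero D}} → x ℚ.* fromℕ D ≡ fromℤ i → x ≡ i / D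
*-fromℕ⇒≡/ i D xD≡i =
  *-cancelʳ-invertible (ℤ.+ 1 / D) (/-*-fromℕ (ℤ.+ 1) D) (trans xD≡i (sym (/-*-fromℕ i D)))

∣/∣< : ∀ i D .{{_ : ℕ.NonZero D}} p q .{c : Coprime (suc p) (suc q)} →
       ℤ.∣ i ∣ * suc q ℕ.< suc p * D → ∣ i / D ∣ < mkℚ (ℤ.+ suc p) q c
∣/∣< i (suc d) p q lt = ℚ.toℚᵘ-cancel-< (ℚᵘ.<-respˡ-≃ toℚᵘ-∣/∣ (*<* cross))
  where
  toℚᵘ-∣/∣ : mkℚᵘ (ℤ.+ ℤ.∣ i ∣) d ℚᵘ.≃ toℚᵘ ∣ i / suc d ∣
  toℚᵘ-∣/∣ = ℚᵘ.≃-sym (ℚᵘ.≃-trans (ℚ.toℚᵘ-homo-∣-∣ (i / suc d)) (ℚᵘ.∣-∣-cong (toℚᵘ-/ i d)))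
  cross : ℤ.+ ℤ.∣ i ∣ ℤ.* ℤ.+ suc q ℤ.< ℤ.+ suc p ℤ.* ℤ.+ suc d
  cross = subst₂ ℤ._<_ (ℤ.pos-* ℤ.∣ i ∣ (suc q)) (ℤ.pos-* (suc p) (suc d)) (ℤ.+<+ lt)

a*m+b≤[a+b]*n : ∀ a b {m n} → m ≤ n → 1 ≤ n → a * m + b ≤ (a + b) * n
a*m+b≤[a+b]*n a b {m} {n} m≤n 1≤n = begin
  a * m + b      ≤⟨ +-mono-≤ (*-monoʳ-≤ a m≤n) (m≤m*n b n {{>-nonZero 1≤n}}) ⟩
  a * n + b * n  ≡⟨ *-distribʳ-+ n a b ⟨
  (a + b) * n    ∎
  where open ≤-Reasoning

∣/∣<-linear/quadratic : ∀ i {D} .{{_ : ℕ.NonZero D}} K S p q .{c : Coprime (suc p) (suc q)} →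
  ℤ.∣ i ∣ ≤ K * S → S * S ≤ D → K * suc q ℕ.< S → ∣ i / D ∣ < mkℚ (ℤ.+ suc p) q c
∣/∣<-linear/quadratic i {D} K S p q ∣i∣≤KS S²≤D Kq<S = ∣/∣< i D p q (begin-strict
  ℤ.∣ i ∣ * suc q  ≤⟨ *-monoˡ-≤ (suc q) ∣i∣≤KS ⟩
  K * S * suc q    ≡⟨ solve (K ∷ S ∷ q ∷ []) ℕ-ring ⟩
  S * (K * suc q)  <⟨ *-monoʳ-< S {{>-nonZero (≤-trans (s≤s z≤n) Kq<S)}} Kq<S ⟩
  S * S            ≤⟨ S²≤D ⟩
  D                ≤⟨ m≤n*m D (suc p) ⟩
  suc p * D        ∎)
  where open ≤-Reasoning

sum-sq-deviation : ∀ {A : Set} (v : A → ℕ) μ (L : List A) →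
  foldr ℚ._+_ 0ℚ (map (λ a → (fromℕ (v a) - μ) ℚ.* (fromℕ (v a) - μ)) L)
  ≡ fromℕ (sumℕ (map (λ a → v a * v a) L))
    - (μ ℚ.* fromℕ (sumℕ (map v L)) ℚ.+ μ ℚ.* fromℕ (sumℕ (map v L)))
    ℚ.+ fromℕ (length L) ℚ.* (μ ℚ.* μ)
sum-sq-deviation v μ []      = nil μ
  where
  nil : ∀ μ → 0ℚ ≡ 0ℚ - (μ ℚ.* 0ℚ ℚ.+ μ ℚ.* 0ℚ) ℚ.+ 0ℚ ℚ.* (μ ℚ.* μ)
  nil = solve-∀ ℚ-ring
sum-sq-deviation v μ (a ∷ L) = begin
  (x - μ) ℚ.* (x - μ) ℚ.+ foldr ℚ._+_ 0ℚ (map (λ b → (fromℕ (v b) - μ) ℚ.* (fromℕ (v b) - μ)) L)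
    ≡⟨ cong ((x - μ) ℚ.* (x - μ) ℚ.+_) (sum-sq-deviation v μ L) ⟩
  (x - μ) ℚ.* (x - μ) ℚ.+ (Q - (μ ℚ.* S ℚ.+ μ ℚ.* S) ℚ.+ n ℚ.* (μ ℚ.* μ))
    ≡⟨ expand x μ Q S n ⟩
  (x ℚ.* x ℚ.+ Q) - (μ ℚ.* (x ℚ.+ S) ℚ.+ μ ℚ.* (x ℚ.+ S)) ℚ.+ (1ℚ ℚ.+ n) ℚ.* (μ ℚ.* μ)
    ≡⟨ cong₂ (λ q s → q - (μ ℚ.* s ℚ.+ μ ℚ.* s) ℚ.+ (1ℚ ℚ.+ n) ℚ.* (μ ℚ.* μ)) fromℕ-Q′ fromℕ-S′ ⟨
  fromℕ Q′ - (μ ℚ.* fromℕ S′ ℚ.+ μ ℚ.* fromℕ S′) ℚ.+ (1ℚ ℚ.+ n) ℚ.* (μ ℚ.* μ)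
    ≡⟨ cong (λ l → fromℕ Q′ - (μ ℚ.* fromℕ S′ ℚ.+ μ ℚ.* fromℕ S′) ℚ.+ l ℚ.* (μ ℚ.* μ)) (fromℕ-+ 1 (length L)) ⟨
  fromℕ Q′ - (μ ℚ.* fromℕ S′ ℚ.+ μ ℚ.* fromℕ S′) ℚ.+ fromℕ (suc (length L)) ℚ.* (μ ℚ.* μ) ∎
  where
  open ≡-Reasoning
  x Q S n : ℚ
  x = fromℕ (v a)
  Q = fromℕ (sumℕ (map (λ b → v b * v b) L))
  S = fromℕ (sumℕ (map v L))
  n = fromℕ (length L)
  Q′ S′ : ℕ
  Q′ = v a * v a + sumℕ (map (λ b → v b * v b) L)
  S′ = v a + sumℕ (map v L)
  fromℕ-Q′ : fromℕ Q′ ≡ x ℚ.* x ℚ.+ Q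
  fromℕ-Q′ = trans (fromℕ-+ (v a * v a) _) (cong (ℚ._+ Q) (fromℕ-* (v a) (v a)))
  fromℕ-S′ : fromℕ S′ ≡ x ℚ.+ S
  fromℕ-S′ = fromℕ-+ (v a) _
  expand : ∀ x μ Q S n →
    (x - μ) ℚ.* (x - μ) ℚ.+ (Q - (μ ℚ.* S ℚ.+ μ ℚ.* S) ℚ.+ n ℚ.* (μ ℚ.* μ))
    ≡ (x ℚ.* x ℚ.+ Q) - (μ ℚ.* (x ℚ.+ S) ℚ.+ μ ℚ.* (x ℚ.+ S)) ℚ.+ (1ℚ ℚ.+ n) ℚ.* (μ ℚ.* μ)
  expand = solve-∀ ℚ-ring

variance-identity : ∀ {u X w μ n S Q} → u ℚ.* n ≡ 1ℚ → μ ℚ.* n ≡ S → w ℚ.* (S ℚ.* S) ≡ n ℚ.* n →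
  X ≡ Q - (μ ℚ.* S ℚ.+ μ ℚ.* S) ℚ.+ n ℚ.* (μ ℚ.* μ) → u ℚ.* X ℚ.* w ℚ.* (S ℚ.* S) ≡ n ℚ.* Q - S ℚ.* S
variance-identity {u} {X} {w} {μ} {n} {S} {Q} un≡1 μn≡S wS²≡n² X≡ = begin
  u ℚ.* X ℚ.* w ℚ.* (S ℚ.* S)      ≡⟨ solve (u ∷ X ∷ w ∷ S ∷ []) ℚ-ring ⟩
  u ℚ.* X ℚ.* (w ℚ.* (S ℚ.* S))    ≡⟨ cong (u ℚ.* X ℚ.*_) wS²≡n² ⟩
  u ℚ.* X ℚ.* (n ℚ.* n)            ≡⟨ solve (u ∷ X ∷ n ∷ []) ℚ-ring ⟩
  u ℚ.* n ℚ.* (X ℚ.* n)            ≡⟨ cong (ℚ._* (X ℚ.* n)) un≡1 ⟩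
  1ℚ ℚ.* (X ℚ.* n)                 ≡⟨ cong (λ e → 1ℚ ℚ.* (e ℚ.* n)) X≡ ⟩
  1ℚ ℚ.* ((Q - (μ ℚ.* S ℚ.+ μ ℚ.* S) ℚ.+ n ℚ.* (μ ℚ.* μ)) ℚ.* n)
                                   ≡⟨ solve (n ∷ μ ∷ S ∷ Q ∷ []) ℚ-ring ⟩
  n ℚ.* Q - (μ ℚ.* n ℚ.* S ℚ.+ μ ℚ.* n ℚ.* S) ℚ.+ μ ℚ.* n ℚ.* (μ ℚ.* n)
                                   ≡⟨ cong (λ e → n ℚ.* Q - (e ℚ.* S ℚ.+ e ℚ.* S) ℚ.+ e ℚ.* e) μn≡S ⟩
  n ℚ.* Q - (S ℚ.* S ℚ.+ S ℚ.* S) ℚ.+ S ℚ.* S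
                                   ≡⟨ solve (n ∷ Q ∷ S ∷ []) ℚ-ring ⟩
  n ℚ.* Q - S ℚ.* S                ∎
  where open ≡-Reasoning

cv-unfold : ∀ N (v : Fin (suc N) → ℕ) s → sumℕ (map v (allFin (suc N))) ≡ suc s →
  cv (suc N) v ≡ (ℤ.+ 1 / suc N)
                 ℚ.* foldr ℚ._+_ 0ℚ (map (λ i → (fromℕ (v i) - ℤ.+ suc s / suc N) ℚ.* (fromℕ (v i) - ℤ.+ suc s / suc N))
                                         (allFin (suc N)))
                 ℚ.* (ℤ.+ (suc N * suc N) / (suc s * suc s))
cv-unfold N v s Σv≡S rewrite Σv≡S = refl

cv-moments : ∀ N (v : Fin (suc N) → ℕ) s → sumℕ (map v (allFin (suc N))) ≡ suc s →
  cv (suc N) v ℚ.* (fromℕ (suc s) ℚ.* fromℕ (suc s))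
  ≡ fromℕ (suc N) ℚ.* fromℕ (sumℕ (map (λ i → v i * v i) (allFin (suc N)))) - fromℕ (suc s) ℚ.* fromℕ (suc s)
cv-moments N v s Σv≡S =
  trans (cong (ℚ._* (fromℕ (suc s) ℚ.* fromℕ (suc s))) (cv-unfold N v s Σv≡S))
        (variance-identity {u = ℤ.+ 1 / suc N} {w = ℤ.+ (suc N * suc N) / (suc s * suc s)} {μ = μ}
                           (/-*-fromℕ (ℤ.+ 1) (suc N)) (/-*-fromℕ (ℤ.+ suc s) (suc N)) w-scaling deviations)
  where
  μ : ℚ
  μ = ℤ.+ suc s / suc N
  w-scaling : (ℤ.+ (suc N * suc N) / (suc s * suc s)) ℚ.* (fromℕ (suc s) ℚ.* fromℕ (suc s))
              ≡ fromℕ (suc N) ℚ.* fromℕ (suc N)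
  w-scaling = begin
    (ℤ.+ (suc N * suc N) / (suc s * suc s)) ℚ.* (fromℕ (suc s) ℚ.* fromℕ (suc s))
      ≡⟨ cong ((ℤ.+ (suc N * suc N) / (suc s * suc s)) ℚ.*_) (fromℕ-* (suc s) (suc s)) ⟨
    (ℤ.+ (suc N * suc N) / (suc s * suc s)) ℚ.* fromℕ (suc s * suc s)
      ≡⟨ /-*-fromℕ (ℤ.+ (suc N * suc N)) (suc s * suc s) ⟩
    fromℕ (suc N * suc N)
      ≡⟨ fromℕ-* (suc N) (suc N) ⟩
    fromℕ (suc N) ℚ.* fromℕ (suc N) ∎
    where open ≡-Reasoning
  deviations : foldr ℚ._+_ 0ℚ (map (λ i → (fromℕ (v i) - μ) ℚ.* (fromℕ (v i) - μ)) (allFin (suc N)))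
    ≡ fromℕ (sumℕ (map (λ i → v i * v i) (allFin (suc N))))
      - (μ ℚ.* fromℕ (suc s) ℚ.+ μ ℚ.* fromℕ (suc s)) ℚ.+ fromℕ (suc N) ℚ.* (μ ℚ.* μ)
  deviations = trans (sum-sq-deviation v μ (allFin (suc N)))
    (cong₂ (λ S l → fromℕ (sumℕ (map (λ i → v i * v i) (allFin (suc N))))
                    - (μ ℚ.* fromℕ S ℚ.+ μ ℚ.* fromℕ S) ℚ.+ fromℕ l ℚ.* (μ ℚ.* μ))
           Σv≡S (length-tabulate {n = suc N} (λ i → i)))

target-scaled : ∀ r → target r ℚ.* (fromℕ (2 + r) ℚ.* fromℕ (2 + r)) ≡ (fromℕ r - fromℕ 2) ℚ.* (fromℕ r - fromℕ 2)
target-scaled r = begin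
  q ℚ.* q ℚ.* (k ℚ.* k)      ≡⟨ *-interchange q q k k ⟩
  (q ℚ.* k) ℚ.* (q ℚ.* k)    ≡⟨ cong (λ e → e ℚ.* e) q*k ⟩
  (fromℕ r - fromℕ 2) ℚ.* (fromℕ r - fromℕ 2) ∎
  where
  open ≡-Reasoning
  q k : ℚ
  q = (ℤ.+ r ℤ.- ℤ.+ 2) / (2 + r)
  k = fromℕ (2 + r)
  q*k : q ℚ.* k ≡ fromℕ r - fromℕ 2
  q*k = trans (/-*-fromℕ (ℤ.+ r ℤ.- ℤ.+ 2) (2 + r))
              (trans (fromℤ-+ (ℤ.+ r) (ℤ.- ℤ.+ 2)) (cong (fromℕ r ℚ.+_) (fromℤ-neg (ℤ.+ 2))))

difference-identity : ∀ {c t S k n Q ρ τ} → c ℚ.* (S ℚ.* S) ≡ n ℚ.* Q - S ℚ.* S → t ℚ.* (k ℚ.* k) ≡ (ρ - τ) ℚ.* (ρ - τ) →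
  k ≡ τ ℚ.+ ρ → (c - t) ℚ.* (S ℚ.* S ℚ.* (k ℚ.* k))
                ≡ k ℚ.* k ℚ.* (n ℚ.* Q) - ((ρ ℚ.* ρ ℚ.+ τ ℚ.* τ) ℚ.* (S ℚ.* S) ℚ.+ (ρ ℚ.* ρ ℚ.+ τ ℚ.* τ) ℚ.* (S ℚ.* S))
difference-identity {c} {t} {S} {k} {n} {Q} {ρ} {τ} cS²≡ tk²≡ k≡τ+ρ = begin
  (c - t) ℚ.* (S ℚ.* S ℚ.* (k ℚ.* k))
    ≡⟨ solve (c ∷ t ∷ S ∷ k ∷ []) ℚ-ring ⟩
  c ℚ.* (S ℚ.* S) ℚ.* (k ℚ.* k) - t ℚ.* (k ℚ.* k) ℚ.* (S ℚ.* S)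
    ≡⟨ cong₂ (λ a b → a ℚ.* (k ℚ.* k) - b ℚ.* (S ℚ.* S)) cS²≡ tk²≡ ⟩
  (n ℚ.* Q - S ℚ.* S) ℚ.* (k ℚ.* k) - (ρ - τ) ℚ.* (ρ - τ) ℚ.* (S ℚ.* S)
    ≡⟨ solve (n ∷ Q ∷ S ∷ k ∷ ρ ∷ τ ∷ []) ℚ-ring ⟩
  k ℚ.* k ℚ.* (n ℚ.* Q) - (k ℚ.* k ℚ.+ (ρ - τ) ℚ.* (ρ - τ)) ℚ.* (S ℚ.* S)
    ≡⟨ cong (λ e → k ℚ.* k ℚ.* (n ℚ.* Q) - (e ℚ.* e ℚ.+ (ρ - τ) ℚ.* (ρ - τ)) ℚ.* (S ℚ.* S)) k≡τ+ρ ⟩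
  k ℚ.* k ℚ.* (n ℚ.* Q) - ((τ ℚ.+ ρ) ℚ.* (τ ℚ.+ ρ) ℚ.+ (ρ - τ) ℚ.* (ρ - τ)) ℚ.* (S ℚ.* S)
    ≡⟨ solve (n ∷ Q ∷ S ∷ k ∷ ρ ∷ τ ∷ []) ℚ-ring ⟩
  k ℚ.* k ℚ.* (n ℚ.* Q) - ((ρ ℚ.* ρ ℚ.+ τ ℚ.* τ) ℚ.* (S ℚ.* S) ℚ.+ (ρ ℚ.* ρ ℚ.+ τ ℚ.* τ) ℚ.* (S ℚ.* S)) ∎
  where open ≡-Reasoning

-- Here and below G has m + 2 vertices.
degreeSum squareSum : ℕ → ℕ → ℕ
degreeSum r m = suc ((2 + r) * m + (1 + 2 * r))
squareSum r m = (4 + r * r) * m + 2 * (1 + r + r * r)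

numerator⁺ numerator⁻ denominator : ℕ → ℕ → ℕ
numerator⁺ r m  = (2 + r) * (2 + r) * ((suc m + suc (suc m)) * squareSum r m)
numerator⁻ r m  = (r * r + 2 * 2) * (degreeSum r m * degreeSum r m) + (r * r + 2 * 2) * (degreeSum r m * degreeSum r m)
denominator r m = degreeSum r m * degreeSum r m * ((2 + r) * (2 + r))

quadCoeff lin⁺ const⁺ lin⁻ const⁻ : ℕ → ℕ
quadCoeff r = 2 * ((2 + r) * (2 + r)) * (r * r + 4)
lin⁺ r      = (2 + r) * (2 + r) * (7 * (r * r) + 4 * r + 16)
const⁺ r    = 6 * ((2 + r) * (2 + r)) * (r * r + r + 1)
lin⁻ r      = 8 * (r * r + 4) * (2 + r) * (r + 1)
const⁻ r    = 8 * (r * r + 4) * ((r + 1) * (r + 1))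

numerator⁺-expansion : ∀ r m → numerator⁺ r m ≡ quadCoeff r * (m * m) + (lin⁺ r * m + const⁺ r)
numerator⁺-expansion r m = expand r m
  where
  expand : ∀ r m → (2 + r) * (2 + r) * ((suc m + suc (suc m)) * ((4 + r * r) * m + 2 * (1 + r + r * r)))
    ≡ 2 * ((2 + r) * (2 + r)) * (r * r + 4) * (m * m)
      + ((2 + r) * (2 + r) * (7 * (r * r) + 4 * r + 16) * m + 6 * ((2 + r) * (2 + r)) * (r * r + r + 1))
  expand = solve-∀ ℕ-ring

numerator⁻-expansion : ∀ r m → numerator⁻ r m ≡ quadCoeff r * (m * m) + (lin⁻ r * m + const⁻ r)
numerator⁻-expansion r m = expand r m
  where
  expand : ∀ r m → (r * r + 2 * 2) * (suc ((2 + r) * m + (1 + 2 * r)) * suc ((2 + r) * m + (1 + 2 * r)))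
                   + (r * r + 2 * 2) * (suc ((2 + r) * m + (1 + 2 * r)) * suc ((2 + r) * m + (1 + 2 * r)))
    ≡ 2 * ((2 + r) * (2 + r)) * (r * r + 4) * (m * m)
      + (8 * (r * r + 4) * (2 + r) * (r + 1) * m + 8 * (r * r + 4) * ((r + 1) * (r + 1)))
  expand = solve-∀ ℕ-ring

growthConstant : ℕ → ℕ
growthConstant r = lin⁺ r + const⁺ r + (lin⁻ r + const⁻ r)

m<degreeSum : ∀ r m → m ℕ.< degreeSum r m
m<degreeSum r m = s≤s (≤-trans (m≤m+n m ((1 + r) * m)) (m≤m+n ((2 + r) * m) (1 + 2 * r)))

∣numerator∣≤ : ∀ r m → ℤ.∣ numerator⁺ r m ⊖ numerator⁻ r m ∣ ≤ growthConstant r * degreeSum r m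
∣numerator∣≤ r m = begin
  ℤ.∣ numerator⁺ r m ⊖ numerator⁻ r m ∣
    ≡⟨ cong₂ (λ a b → ℤ.∣ a ⊖ b ∣) (numerator⁺-expansion r m) (numerator⁻-expansion r m) ⟩
  ℤ.∣ (W + x) ⊖ (W + y) ∣
    ≡⟨ cong ℤ.∣_∣ (ℤ.+-cancelˡ-⊖ W x y) ⟩
  ℤ.∣ x ⊖ y ∣
    ≤⟨ ℤ.∣m⊝n∣≤m⊔n x y ⟩
  x ⊔ y
    ≤⟨ m⊔n≤m+n x y ⟩
  x + y
    ≤⟨ +-mono-≤ (a*m+b≤[a+b]*n (lin⁺ r) (const⁺ r) m≤S 1≤S) (a*m+b≤[a+b]*n (lin⁻ r) (const⁻ r) m≤S 1≤S) ⟩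
  (lin⁺ r + const⁺ r) * S + (lin⁻ r + const⁻ r) * S
    ≡⟨ *-distribʳ-+ S (lin⁺ r + const⁺ r) (lin⁻ r + const⁻ r) ⟨
  growthConstant r * S ∎
  where
  open ≤-Reasoning
  S W x y : ℕ
  S = degreeSum r m
  W = quadCoeff r * (m * m)
  x = lin⁺ r * m + const⁺ r
  y = lin⁻ r * m + const⁻ r
  m≤S : m ≤ S
  m≤S = <⇒≤ (m<degreeSum r m)
  1≤S : 1 ≤ S
  1≤S = s≤s z≤n

module _ {r m : ℕ} (G : Graph (suc (suc m))) (reg : Regular r G) where

  degreeSum-pathGlue : sumℕ (map (degVecPathGlue G) (allFin (suc m + suc (suc m)))) ≡ degreeSum r m
  degreeSum-pathGlue = begin
    sumℕ (map (degVecPathGlue G) (allFin (suc m + suc (suc m)))) ≡⟨ sumℕ-map-allFin (degVecPathGlue G) ⟩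
    sumFin (degVecPathGlue G)                                    ≡⟨ sum-degVecPathGlue G reg (λ d → d) ⟩
    1 + m * 2 + (suc r + suc m * r)                              ≡⟨ closedForm m r ⟩
    suc ((2 + r) * m + (1 + 2 * r))                              ∎
    where
    open ≡-Reasoning
    closedForm : ∀ m r → 1 + m * 2 + (suc r + suc m * r) ≡ suc ((2 + r) * m + (1 + 2 * r))
    closedForm = solve-∀ ℕ-ring

  squareSum-pathGlue : sumℕ (map (λ x → degVecPathGlue G x * degVecPathGlue G x) (allFin (suc m + suc (suc m))))
                       ≡ squareSum r m
  squareSum-pathGlue = begin
    sumℕ (map (λ x → degVecPathGlue G x * degVecPathGlue G x) (allFin (suc m + suc (suc m))))
      ≡⟨ sumℕ-map-allFin (λ x → degVecPathGlue G x * degVecPathGlue G x) ⟩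
    sumFin (λ x → degVecPathGlue G x * degVecPathGlue G x)
      ≡⟨ sum-degVecPathGlue G reg (λ d → d * d) ⟩
    1 * 1 + m * (2 * 2) + (suc r * suc r + suc m * (r * r))
      ≡⟨ closedForm m r ⟩
    squareSum r m ∎
    where
    open ≡-Reasoning
    closedForm : ∀ m r → 1 * 1 + m * (2 * 2) + (suc r * suc r + suc m * (r * r)) ≡ (4 + r * r) * m + 2 * (1 + r + r * r)
    closedForm = solve-∀ ℕ-ring

  cdPathGlue-target : cdPathGlue G - target r ≡ (numerator⁺ r m ⊖ numerator⁻ r m) / denominator r m
  cdPathGlue-target = *-fromℕ⇒≡/ (numerator⁺ r m ⊖ numerator⁻ r m) (denominator r m) (begin
    (c - target r) ℚ.* fromℕ (denominator r m)
      ≡⟨ cong ((c - target r) ℚ.*_) (trans (fromℕ-* (S * S) (k * k)) (cong₂ ℚ._*_ (fromℕ-* S S) (fromℕ-* k k))) ⟩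
    (c - target r) ℚ.* (fromℕ S ℚ.* fromℕ S ℚ.* (fromℕ k ℚ.* fromℕ k))
      ≡⟨ difference-identity {c = c} {t = target r} {S = fromℕ S} {k = fromℕ k} {n = fromℕ N} {Q = fromℕ Q}
                             {ρ = fromℕ r} {τ = fromℕ 2} cS² (target-scaled r) (fromℕ-+ 2 r) ⟩
    fromℕ k ℚ.* fromℕ k ℚ.* (fromℕ N ℚ.* fromℕ Q) - (V̂ ℚ.+ V̂)
      ≡⟨ cong₂ _-_ fromℕ-numerator⁺ fromℕ-numerator⁻ ⟨
    fromℕ (numerator⁺ r m) - fromℕ (numerator⁻ r m)
      ≡⟨ fromℤ-⊖ (numerator⁺ r m) (numerator⁻ r m) ⟨
    fromℤ (numerator⁺ r m ⊖ numerator⁻ r m) ∎)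
    where
    open ≡-Reasoning
    c : ℚ
    c = cdPathGlue G
    S k N Q V : ℕ
    S = degreeSum r m
    k = 2 + r
    N = suc m + suc (suc m)
    Q = squareSum r m
    V = (r * r + 2 * 2) * (S * S)
    V̂ : ℚ
    V̂ = (fromℕ r ℚ.* fromℕ r ℚ.+ fromℕ 2 ℚ.* fromℕ 2) ℚ.* (fromℕ S ℚ.* fromℕ S)
    cS² : c ℚ.* (fromℕ S ℚ.* fromℕ S) ≡ fromℕ N ℚ.* fromℕ Q - fromℕ S ℚ.* fromℕ S
    cS² = trans (cv-moments (m + suc (suc m)) (degVecPathGlue G) _ degreeSum-pathGlue)
                (cong (λ e → fromℕ N ℚ.* fromℕ e - fromℕ S ℚ.* fromℕ S) squareSum-pathGlue)
    fromℕ-numerator⁺ : fromℕ (numerator⁺ r m) ≡ fromℕ k ℚ.* fromℕ k ℚ.* (fromℕ N ℚ.* fromℕ Q)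
    fromℕ-numerator⁺ = trans (fromℕ-* (k * k) (N * Q)) (cong₂ ℚ._*_ (fromℕ-* k k) (fromℕ-* N Q))
    fromℕ-V : fromℕ V ≡ V̂
    fromℕ-V = trans (fromℕ-* (r * r + 2 * 2) (S * S))
      (cong₂ ℚ._*_ (trans (fromℕ-+ (r * r) (2 * 2)) (cong₂ ℚ._+_ (fromℕ-* r r) (fromℕ-* 2 2))) (fromℕ-* S S))
    fromℕ-numerator⁻ : fromℕ (numerator⁻ r m) ≡ V̂ ℚ.+ V̂
    fromℕ-numerator⁻ = trans (fromℕ-+ V V) (cong₂ ℚ._+_ fromℕ-V fromℕ-V)

mainTheorem13 : (r : ℕ) → (G : (n : ℕ) → Maybe (Graph n)) →
    (∀ n g → G n ≡ just g → Regular r g × Connected g) →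
    ∀ (ε : ℚ) → 0ℚ < ε → ∃[ N ] (∀ n g → G n ≡ just g → N ≤ n →
    ∣ cdPathGlue g - target r ∣ < ε)
mainTheorem13 r G hG ε@(mkℚ ℤ.+[1+ p ] q _) _ = 2 + growthConstant r * suc q , close
  where
  close : ∀ n g → G n ≡ just g → 2 + growthConstant r * suc q ≤ n → ∣ cdPathGlue g - target r ∣ < ε
  close (suc (suc m)) g Gn≡g (s≤s (s≤s Kq≤m)) =
    subst (λ d → ∣ d ∣ < ε) (sym (cdPathGlue-target g (proj₁ (hG _ g Gn≡g))))
      (∣/∣<-linear/quadratic (numerator⁺ r m ⊖ numerator⁻ r m) (growthConstant r) (degreeSum r m) p q
        (∣numerator∣≤ r m) (m≤m*n _ ((2 + r) * (2 + r))) (≤-<-trans Kq≤m (m<degreeSum r m)))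
mainTheorem13 r G hG (mkℚ (ℤ.+ 0) q _) (ℚ.*<* (ℤ.+<+ ()))
mainTheorem13 r G hG (mkℚ ℤ.-[1+ _ ] q _) (ℚ.*<* ())
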